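{- Let $r$ and $\alpha$ be positive integers, and let $c$ be a real number. Let $t=p_1^{\alpha_1}\cdots p_r^{\alpha_r}$, where $p_1,\ldots,p_r$ are distinct odd primes and $\alpha_1,\ldots,\alpha_r$ are positive integers. Then $2^{\alpha}t\in V(c)$ if and only if $\sum_{i=1}^r\alpha_i\eta(p_i)<c+1$.
   Context: Let $\overline{\psi}$ be the multiplicative arithmetic function with $\overline{\psi}(p^{\alpha})=p^{\alpha-1}(p+1)$ for odd primes $p$ and $\overline{\psi}(2^{\alpha})=2^{\alpha-1}$, for all positive integers $\alpha$ (so $\overline{\psi}(1)=1$). For $n>1$, $\lambda(n)$ is the unique nonnegative integer with $\overline{\psi}^{\lambda(n)}(n)=2$ (where $\overline{\psi}^k$ is the $k$-th iterate, $\overline{\psi}^0(n)=n$), and $\lambda(1)=0$. For a real number $c$, $V(c)=\{n\in\mathbb{N}\colon n>2^{\lambda(n)-c}\}$. For an odd prime $p$, $\eta(p)=\lambda(p)-\log_2(p)$. -}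

module Defs where

open import Data.Nat using (ℕ; zero; suc; _+_; _*_; _^_; _<_)
open import Data.Nat.Coprimality using (Coprime)
open import Data.Nat.Primality using (Prime)
open import Data.Fin using (Fin; zero; suc)
open import Data.Integer as ℤ using (ℤ; +_; -[1+_])
open import Data.Rational as ℚ using (ℚ; ↥_; ↧ₙ_)
open import Data.Product using (Σ; ∃; _×_)
open import Relation.Nullary using (¬_)
open import Relation.Binary.PropositionalEquality using (_≡_; _≢_)

iterate : (ℕ → ℕ) → ℕ → ℕ → ℕ
iterate f zero    n = n
iterate f (suc k) n = f (iterate f k n)

record IsPsiBar (f : ℕ → ℕ) : Set where
  field
    one      : f 1 ≡ 1
    mult     : ∀ m n → Coprime m n → f (m * n) ≡ f m * f n
    oddPrime : ∀ p a → Prime p → p ≢ 2 → f (p ^ suc a) ≡ p ^ a * (p + 1)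
    two      : ∀ a → f (2 ^ suc a) ≡ 2 ^ a

-- λ(n) = k for n > 1: the unique k with ψ̄^k(n) = 2.
IsLambda : (ℕ → ℕ) → ℕ → ℕ → Set
IsLambda f n k = iterate f k n ≡ 2

-- Real numbers as Dedekind lower cuts of ℚ (open, inhabited, bounded, down-closed).
record ℝ : Set₁ where
  field
    L        : ℚ → Set
    inhabited : ∃ λ q → L q
    bounded  : ∃ λ q → ¬ L q
    lower    : ∀ {p q} → p ℚ.≤ q → L q → L p
    rounded  : ∀ {q} → L q → ∃ λ r → q ℚ.< r × L r
open ℝ public

-- TwoPowLt e m  :⇔  2^e < m   (e an integer exponent)
TwoPowLt : ℤ → ℕ → Set
TwoPowLt (+ k)      m = 2 ^ k < m
TwoPowLt -[1+ k ]   m = 1 < 2 ^ suc k * m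

-- c >[ K ]-log₂ m  :⇔  c > K - log₂ m   (m ≥ 1).
-- Since c = sup (L c) with L c open: c > x iff some q ∈ L c has q > x,
-- and for q = a/d (d > 0):  q > K - log₂ m  iff  2^(K d - a) < m^d.
_>[_]-log₂_ : ℝ → ℤ → ℕ → Set
c >[ K ]-log₂ m = ∃ λ q → L c q × TwoPowLt (K ℤ.* (+ (↧ₙ q)) ℤ.- (↥ q)) (m ^ (↧ₙ q))

∑ : ∀ {r} → (Fin r → ℕ) → ℕ
∑ {zero}  g = 0
∑ {suc r} g = g zero + ∑ (λ i → g (suc i))

∏ : ∀ {r} → (Fin r → ℕ) → ℕ
∏ {zero}  g = 1
∏ {suc r} g = g zero * ∏ (λ i → g (suc i))

{-# OPTIONS --safe #-}
-- Say that n shifts λ by w if λ(n y) = λ(y) + w for every even y ≥ 1; such shifts add up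
-- under multiplication.  The prime 2 shifts by 1, because f(2y) = 2 f(y) for even y and the
-- orbit of an even number stays even until it reaches 2.  An odd prime q = 2z − 1 shifts by
-- 1 plus the shift of z, because f(q y) is q f(y) or z (2 f(y)).  By strong induction every
-- n ≥ 1 shifts λ, necessarily by λ(2n), which equals λ(n) for odd n.  Hence
-- λ(2^α t) = α − 1 + Σ aᵢ λ(pᵢ),
-- and 2^α t > 2^(λ(2^α t) − c) says exactly that t > 2^(Σ aᵢ λ(pᵢ) − 1 − c).
module Submission where

open import Defs
open import Data.Nat
  using (ℕ; zero; suc; _+_; _*_; _^_; _≤_; _<_; z≤n; s≤s; >-nonZero; >-nonZero⁻¹; nonTrivial⇒n>1)
open import Data.Nat.Properties
open import Data.Nat.Divisibility
  using (_∣_; divides; _∣?_; quotient; m∣n⇒n≡m*quotient; m∣m*n; ∣m⇒∣m*n; ∣n⇒∣m*n; ∣⇒≤; ∣-refl; ∣-trans;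
         ∣1⇒≡1; _∣0)
open import Data.Nat.Coprimality using (Coprime; coprime-divisor)
open import Data.Nat.Primality using (Prime; prime[2]; prime⇒irreducible; prime⇒nonTrivial)
open import Data.Nat.Primality.Factorisation using (factorise)
open import Data.Nat.Induction using (<-rec)
open import Data.List using ([]; _∷_)
open import Data.Nat.ListAction using (product)
open import Data.List.Relation.Unary.All using (_∷_)
open import Data.Fin as Fin using (Fin)
open import Data.Integer as ℤ using (+_; -[1+_])
import Data.Integer.Properties as ℤ
open import Data.Integer.Tactic.RingSolver using (solve-∀)
open import Data.Rational using (↥_; ↧ₙ_)
open import Data.Product using (∃; ∃₂; _×_; _,_; map₂)
open import Data.Sum using (_⊎_; inj₁; inj₂)
open import Data.Empty using (⊥-elim)
open import Function using (_∘_)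
open import Function.Definitions using (Injective)
open import Function.Bundles using (_⇔_; mk⇔; Equivalence)
import Function.Properties.Equivalence as ⇔
open import Relation.Nullary using (¬_; Dec; yes; no)
open import Relation.Binary.PropositionalEquality

prime⇒1< : ∀ {q} → Prime q → 1 < q
prime⇒1< {q} pq = nonTrivial⇒n>1 q {{prime⇒nonTrivial pq}}

m<n*m : ∀ {m n} → 1 ≤ m → 1 < n → m < n * m
m<n*m {m} {n} 1≤m 1<n = subst (m <_) (*-comm m n) (m<m*n m n {{>-nonZero 1≤m}} 1<n)

1≤*⇒1≤ʳ : ∀ m {n} → 1 ≤ m * n → 1 ≤ n
1≤*⇒1≤ʳ m 1≤mn = >-nonZero⁻¹ _ {{m*n≢0⇒n≢0 m {{>-nonZero 1≤mn}}}}

2∣⊎2∣+1 : ∀ n → 2 ∣ n ⊎ 2 ∣ n + 1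
2∣⊎2∣+1 zero = inj₁ (2 ∣0)
2∣⊎2∣+1 (suc n) with 2∣⊎2∣+1 n
... | inj₁ (divides q refl) = inj₂ (divides (suc q) (cong suc (+-comm (q * 2) 1)))
... | inj₂ 2∣n+1 = inj₁ (subst (2 ∣_) (+-comm n 1) 2∣n+1)

odd⇒2∣+1 : ∀ {n} → ¬ 2 ∣ n → 2 ∣ n + 1
odd⇒2∣+1 {n} 2∤n with 2∣⊎2∣+1 n
... | inj₁ 2∣n = ⊥-elim (2∤n 2∣n)
... | inj₂ 2∣n+1 = 2∣n+1

odd⇒1≤ : ∀ {n} → ¬ 2 ∣ n → 1 ≤ n
odd⇒1≤ {zero} 2∤0 = ⊥-elim (2∤0 (2 ∣0))
odd⇒1≤ {suc _} _ = s≤s z≤n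

prime≢2⇒odd : ∀ {q} → Prime q → q ≢ 2 → ¬ 2 ∣ q
prime≢2⇒odd pq q≢2 2∣q with prime⇒irreducible pq 2∣q
... | inj₂ 2≡q = q≢2 (sym 2≡q)

prime∤⇒coprime : ∀ {q n} → Prime q → ¬ q ∣ n → Coprime q n
prime∤⇒coprime pq q∤n (d∣q , d∣n) with prime⇒irreducible pq d∣q
... | inj₁ d≡1 = d≡1
... | inj₂ refl = ⊥-elim (q∤n d∣n)

coprime-*ˡ : ∀ {m n k} → Coprime m k → Coprime n k → Coprime (m * n) k
coprime-*ˡ {m} {n} {k} m⊥k n⊥k {d} (d∣mn , d∣k) = n⊥k (coprime-divisor d⊥m d∣mn , d∣k)
  where
  d⊥m : Coprime d m
  d⊥m (e∣d , e∣m) = m⊥k (e∣m , ∣-trans e∣d d∣k)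

coprime-^ˡ : ∀ {m k} → Coprime m k → ∀ a → Coprime (m ^ a) k
coprime-^ˡ m⊥k zero (d∣1 , _) = ∣1⇒≡1 d∣1
coprime-^ˡ m⊥k (suc a) = coprime-*ˡ m⊥k (coprime-^ˡ m⊥k a)

^-distribʳ-* : ∀ m n a → (m * n) ^ a ≡ m ^ a * n ^ a
^-distribʳ-* m n zero = refl
^-distribʳ-* m n (suc a) = begin
  m * n * (m * n) ^ a     ≡⟨ cong (m * n *_) (^-distribʳ-* m n a) ⟩
  m * n * (m ^ a * n ^ a) ≡⟨ *-assoc m n _ ⟩
  m * (n * (m ^ a * n ^ a)) ≡⟨ cong (m *_) (x∙yz≈y∙xz n (m ^ a) (n ^ a)) ⟩
  m * (m ^ a * (n * n ^ a)) ≡⟨ *-assoc m (m ^ a) _ ⟨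
  m * m ^ a * (n * n ^ a) ∎
  where
  open ≡-Reasoning
  open import Algebra.Properties.CommutativeSemigroup *-commutativeSemigroup using (x∙yz≈y∙xz)

∃-prime-∣ : ∀ {n} → 1 < n → ∃ λ q → Prime q × q ∣ n
∃-prime-∣ {n} 1<n with factorise n {{>-nonZero (<-trans (s≤s z≤n) 1<n)}}
... | record { factors = q ∷ qs ; isFactorisation = n≡q*∏qs ; factorsPrime = pq ∷ _ } =
  q , pq , divides (product qs) (trans n≡q*∏qs (*-comm q _))
... | record { factors = [] ; isFactorisation = refl } = ⊥-elim (<-irrefl refl 1<n)

prime-*-induction : (P : ℕ → Set) → P 1 →
  (∀ {q n} → Prime q → 1 ≤ n → (∀ {m} → 1 ≤ m → m < q * n → P m) → P (q * n)) →
  ∀ n → 1 ≤ n → P n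
prime-*-induction P P1 P* = <-rec (λ n → 1 ≤ n → P n) go
  where
  go : ∀ n → (∀ {m} → m < n → 1 ≤ m → P m) → 1 ≤ n → P n
  go 1 _ _ = P1
  go n@(suc (suc _)) rec 1≤n with ∃-prime-∣ {n} (s≤s (s≤s z≤n))
  ... | q , pq , q∣n = subst P (sym n≡q*m)
      (P* pq (1≤*⇒1≤ʳ q (subst (1 ≤_) n≡q*m 1≤n))
          (λ {k} 1≤k k<qm → rec (subst (k <_) (sym n≡q*m) k<qm) 1≤k))
    where
    n≡q*m : n ≡ q * quotient q∣n
    n≡q*m = m∣n⇒n≡m*quotient q∣n

factor-out : ∀ {q} → 1 < q → ∀ n → 1 ≤ n → ∃₂ λ a m → n ≡ q ^ a * m × ¬ q ∣ m
factor-out {q} 1<q = <-rec (λ n → 1 ≤ n → ∃₂ λ a m → n ≡ q ^ a * m × ¬ q ∣ m) go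
  where
  go : ∀ n → (∀ {k} → k < n → 1 ≤ k → ∃₂ λ a m → k ≡ q ^ a * m × ¬ q ∣ m) →
       1 ≤ n → ∃₂ λ a m → n ≡ q ^ a * m × ¬ q ∣ m
  go n rec 1≤n with q ∣? n
  ... | no q∤n = 0 , n , sym (+-identityʳ n) , q∤n
  ... | yes q∣n = let (a , m , n'≡qᵃm , q∤m) = rec n'<n 1≤n' in
    suc a , m , trans n≡q*n' (trans (cong (q *_) n'≡qᵃm) (sym (*-assoc q (q ^ a) m))) , q∤m
    where
    n' = quotient q∣n
    n≡q*n' = m∣n⇒n≡m*quotient q∣n
    1≤n' = 1≤*⇒1≤ʳ q (subst (1 ≤_) n≡q*n' 1≤n)
    n'<n = subst (n' <_) (sym n≡q*n') (m<n*m 1≤n' 1<q)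

iterate-suc : ∀ g k n → iterate g (suc k) n ≡ iterate g k (g n)
iterate-suc g zero n = refl
iterate-suc g (suc k) n = cong g (iterate-suc g k n)

TwoPowLt-double : ∀ E m → TwoPowLt (ℤ.suc E) (2 * m) ⇔ TwoPowLt E m
TwoPowLt-double (+ e) m = mk⇔ (*-cancelˡ-< 2 (2 ^ e) m) (*-monoʳ-< 2)
TwoPowLt-double -[1+ 0 ] m = ⇔.refl
TwoPowLt-double -[1+ suc e ] m
  rewrite sym (*-assoc (2 ^ suc e) 2 m) | *-comm (2 ^ suc e) 2 = ⇔.refl

ℤ-+-suc : ∀ i j → i ℤ.+ (+ 1 ℤ.+ j) ≡ + 1 ℤ.+ (i ℤ.+ j)
ℤ-+-suc = solve-∀

TwoPowLt-shift : ∀ E A m → TwoPowLt (E ℤ.+ + A) (2 ^ A * m) ⇔ TwoPowLt E m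
TwoPowLt-shift E zero m rewrite ℤ.+-identityʳ E | *-identityˡ m = ⇔.refl
TwoPowLt-shift E (suc A) m rewrite ℤ-+-suc E (+ A) | *-assoc 2 (2 ^ A) m =
  ⇔.trans (TwoPowLt-double (E ℤ.+ + A) (2 ^ A * m)) (TwoPowLt-shift E A m)

>-log₂-shift : ∀ c K A m → (c >[ K ℤ.+ + A ]-log₂ (2 ^ A * m)) ⇔ (c >[ K ]-log₂ m)
>-log₂-shift c K A m =
  mk⇔ (map₂ λ {q} → map₂ (Equivalence.to (at q))) (map₂ λ {q} → map₂ (Equivalence.from (at q)))
  where
  exponent : ∀ d a → (K ℤ.+ + A) ℤ.* + d ℤ.- a ≡ (K ℤ.* + d ℤ.- a) ℤ.+ + (A * d)
  exponent d a = trans (expand K (+ A) (+ d) a)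
    (cong (λ i → (K ℤ.* + d ℤ.- a) ℤ.+ i) (sym (ℤ.pos-* A d)))
    where
    expand : ∀ K A d a → (K ℤ.+ A) ℤ.* d ℤ.- a ≡ (K ℤ.* d ℤ.- a) ℤ.+ A ℤ.* d
    expand = solve-∀
  at : ∀ q → TwoPowLt ((K ℤ.+ + A) ℤ.* + ↧ₙ q ℤ.- ↥ q) ((2 ^ A * m) ^ ↧ₙ q)
             ⇔ TwoPowLt (K ℤ.* + ↧ₙ q ℤ.- ↥ q) (m ^ ↧ₙ q)
  at q rewrite exponent (↧ₙ q) (↥ q) | ^-distribʳ-* (2 ^ A) m (↧ₙ q) | ^-*-assoc 2 A (↧ₙ q) =
    TwoPowLt-shift _ (A * ↧ₙ q) (m ^ ↧ₙ q)

module PsiBar {f : ℕ → ℕ} (ψ : IsPsiBar f) where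
  open IsPsiBar ψ

  f-2 : f 2 ≡ 1
  f-2 = two 0

  f-oddPrime : ∀ {q} → Prime q → q ≢ 2 → f q ≡ q + 1
  f-oddPrime {q} pq q≢2 = trans (cong f (sym (*-identityʳ q)))
    (trans (oddPrime q 0 pq q≢2) (*-identityˡ (q + 1)))

  f-prime-pos : ∀ {q} → Prime q → 1 ≤ f q
  f-prime-pos {q} pq with q ≟ 2
  ... | yes refl = ≤-reflexive (sym f-2)
  ... | no q≢2 = subst (1 ≤_) (sym (f-oddPrime pq q≢2)) (m≤n+m 1 q)

  f-prime^ : ∀ {q} → Prime q → ∀ b → f (q ^ suc b) ≡ q ^ b * f q
  f-prime^ {q} pq b with q ≟ 2
  ... | yes refl = trans (two b) (trans (sym (*-identityʳ (2 ^ b))) (cong (2 ^ b *_) (sym f-2)))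
  ... | no q≢2 = trans (oddPrime q b pq q≢2) (cong (q ^ b *_) (sym (f-oddPrime pq q≢2)))

  f-*-coprime : ∀ {q n} → Prime q → ¬ q ∣ n → f (q * n) ≡ f q * f n
  f-*-coprime pq q∤n = mult _ _ (prime∤⇒coprime pq q∤n)

  f-2*-odd : ∀ {n} → ¬ 2 ∣ n → f (2 * n) ≡ f n
  f-2*-odd {n} 2∤n =
    trans (f-*-coprime prime[2] 2∤n) (trans (cong (_* f n) f-2) (*-identityˡ (f n)))

  f-prime^* : ∀ {q m} → Prime q → ¬ q ∣ m → ∀ b → f (q ^ suc b * m) ≡ q ^ b * (f q * f m)
  f-prime^* {q} {m} pq q∤m b = begin
    f (q ^ suc b * m)      ≡⟨ mult _ _ (coprime-^ˡ (prime∤⇒coprime pq q∤m) (suc b)) ⟩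
    f (q ^ suc b) * f m    ≡⟨ cong (_* f m) (f-prime^ pq b) ⟩
    q ^ b * f q * f m      ≡⟨ *-assoc (q ^ b) (f q) (f m) ⟩
    q ^ b * (f q * f m)    ∎
    where open ≡-Reasoning

  f-*-∣ : ∀ {q n} → Prime q → 1 ≤ n → q ∣ n → f (q * n) ≡ q * f n
  f-*-∣ {q} pq 1≤n q∣n with factor-out (prime⇒1< pq) _ 1≤n
  ... | zero , m , refl , q∤m = ⊥-elim (q∤m (subst (q ∣_) (*-identityˡ m) q∣n))
  ... | suc b , m , refl , q∤m = begin
    f (q * (q ^ suc b * m))      ≡⟨ cong f (*-assoc q (q ^ suc b) m) ⟨
    f (q ^ suc (suc b) * m)      ≡⟨ f-prime^* pq q∤m (suc b) ⟩
    q * q ^ b * (f q * f m)      ≡⟨ *-assoc q (q ^ b) _ ⟩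
    q * (q ^ b * (f q * f m))    ≡⟨ cong (q *_) (f-prime^* pq q∤m b) ⟨
    q * f (q ^ suc b * m)        ∎
    where open ≡-Reasoning

  f-pos : ∀ {n} → 1 ≤ n → 1 ≤ f n
  f-pos {n} = prime-*-induction (λ n → 1 ≤ f n) (≤-reflexive (sym one)) step n
    where
    step : ∀ {q n} → Prime q → 1 ≤ n → (∀ {m} → 1 ≤ m → m < q * n → 1 ≤ f m) → 1 ≤ f (q * n)
    step {q} {n} pq 1≤n ih with q ∣? n
    ... | yes q∣n = subst (1 ≤_) (sym (f-*-∣ pq 1≤n q∣n))
                      (*-mono-≤ (<⇒≤ (prime⇒1< pq)) (ih 1≤n (m<n*m 1≤n (prime⇒1< pq))))
    ... | no q∤n = subst (1 ≤_) (sym (f-*-coprime pq q∤n))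
                      (*-mono-≤ (f-prime-pos pq) (ih 1≤n (m<n*m 1≤n (prime⇒1< pq))))

  2∣f-oddPrime-multiple : ∀ {q n} → Prime q → q ≢ 2 → q ∣ n → 1 ≤ n → 2 ∣ f n
  2∣f-oddPrime-multiple {q} pq q≢2 q∣n 1≤n with factor-out (prime⇒1< pq) _ 1≤n
  ... | zero , m , refl , q∤m = ⊥-elim (q∤m (subst (q ∣_) (*-identityˡ m) q∣n))
  ... | suc b , m , refl , q∤m = subst (2 ∣_) (sym (f-prime^* pq q∤m b))
    (∣n⇒∣m*n (q ^ b) (∣m⇒∣m*n (f m) 2∣fq))
    where
    2∣fq : 2 ∣ f q
    2∣fq = subst (2 ∣_) (sym (f-oddPrime pq q≢2)) (odd⇒2∣+1 (prime≢2⇒odd pq q≢2))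

  2∣f-even : ∀ {y} → 1 ≤ y → 2 ∣ y → y ≢ 2 → 2 ∣ f y
  2∣f-even {y} 1≤y 2∣y y≢2 = subst (λ n → 2 ∣ f n) (sym y≡2x) (by-parity (2 ∣? x))
    where
    x = quotient 2∣y
    y≡2x = m∣n⇒n≡m*quotient 2∣y
    1≤x = 1≤*⇒1≤ʳ 2 (subst (1 ≤_) y≡2x 1≤y)
    by-parity : Dec (2 ∣ x) → 2 ∣ f (2 * x)
    by-parity (yes 2∣x) = subst (2 ∣_) (sym (f-*-∣ prime[2] 1≤x 2∣x)) (m∣m*n (f x))
    by-parity (no 2∤x) =
      let (q , pq , q∣x) = ∃-prime-∣ (≤∧≢⇒< 1≤x λ 1≡x → y≢2 (trans y≡2x (cong (2 *_) (sym 1≡x))))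
          q≢2 q≡2 = 2∤x (subst (_∣ x) q≡2 q∣x)
      in subst (2 ∣_) (sym (f-2*-odd 2∤x)) (2∣f-oddPrime-multiple pq q≢2 q∣x 1≤x)

  data Λ : ℕ → ℕ → Set where
    Λ-2 : Λ 2 0
    Λ-f : ∀ {n k} → Λ (f n) k → Λ n (suc k)

  isLambda⇒Λ : ∀ {n} k → IsLambda f n k → Λ n k
  isLambda⇒Λ zero refl = Λ-2
  isLambda⇒Λ {n} (suc k) h = Λ-f (isLambda⇒Λ k (trans (sym (iterate-suc f k n)) h))

  ¬Λ-1 : ∀ {k} → ¬ Λ 1 k
  ¬Λ-1 {suc k} (Λ-f l) = ¬Λ-1 {k} (subst (λ n → Λ n k) one l)

  ¬Λ-2-suc : ∀ {k} → ¬ Λ 2 (suc k)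
  ¬Λ-2-suc {k} (Λ-f l) = ¬Λ-1 (subst (λ n → Λ n k) f-2 l)

  Λ-unique : ∀ {n k k′} → Λ n k → Λ n k′ → k ≡ k′
  Λ-unique Λ-2 Λ-2 = refl
  Λ-unique Λ-2 l′@(Λ-f _) = ⊥-elim (¬Λ-2-suc l′)
  Λ-unique l@(Λ-f _) Λ-2 = ⊥-elim (¬Λ-2-suc l)
  Λ-unique (Λ-f l) (Λ-f l′) = cong suc (Λ-unique l l′)

  Λ-2^ : ∀ b → Λ (2 ^ suc b) b
  Λ-2^ zero = Λ-2
  Λ-2^ (suc b) = Λ-f (subst (λ n → Λ n b) (sym (two (suc b))) (Λ-2^ b))

  Λ-2*-odd : ∀ {n k} → ¬ 2 ∣ n → Λ n k → Λ (2 * n) k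
  Λ-2*-odd 2∤n Λ-2 = ⊥-elim (2∤n ∣-refl)
  Λ-2*-odd {k = suc k} 2∤n (Λ-f l) = Λ-f (subst (λ m → Λ m k) (sym (f-2*-odd 2∤n)) l)

  even-orbit : ∀ {y u} → 1 ≤ y → 2 ∣ y → Λ y (suc u) → 1 ≤ f y × 2 ∣ f y × Λ (f y) u
  even-orbit 1≤y 2∣y (Λ-f l) = f-pos 1≤y , 2∣f-even 1≤y 2∣y (λ { refl → ¬Λ-2-suc (Λ-f l) }) , l

  ShiftsBy : ℕ → ℕ → Set
  ShiftsBy n w = ∀ {y u} → 1 ≤ y → 2 ∣ y → Λ y u → Λ (n * y) (u + w)

  shiftsBy⇒Λ : ∀ {n w} → ShiftsBy n w → Λ (n * 2) w
  shiftsBy⇒Λ s = s (s≤s z≤n) ∣-refl Λ-2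

  shiftsBy-1 : ShiftsBy 1 0
  shiftsBy-1 {y} {u} _ _ l = subst₂ Λ (sym (*-identityˡ y)) (sym (+-identityʳ u)) l

  shiftsBy-* : ∀ {m v n w} → 1 ≤ m → ShiftsBy m v → ShiftsBy n w → ShiftsBy (m * n) (v + w)
  shiftsBy-* {m} {v} {n} {w} 1≤m sm sn {y} {u} 1≤y 2∣y l =
    subst₂ Λ (trans (sym (*-assoc n m y)) (cong (_* y) (*-comm n m))) (+-assoc u v w)
      (sn (*-mono-≤ 1≤m 1≤y) (∣n⇒∣m*n m 2∣y) (sm 1≤y 2∣y l))

  shiftsBy-^ : ∀ {n w} → 1 ≤ n → ShiftsBy n w → ∀ a → ShiftsBy (n ^ a) (a * w)
  shiftsBy-^ 1≤n s zero = shiftsBy-1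
  shiftsBy-^ 1≤n s (suc a) = shiftsBy-* 1≤n s (shiftsBy-^ 1≤n s a)

  shiftsBy-∏ : ∀ {r} {g w : Fin r → ℕ} → (∀ i → 1 ≤ g i) → (∀ i → ShiftsBy (g i) (w i)) →
    ShiftsBy (∏ g) (∑ w)
  shiftsBy-∏ {zero} _ _ = shiftsBy-1
  shiftsBy-∏ {suc r} 1≤g s =
    shiftsBy-* (1≤g Fin.zero) (s Fin.zero) (shiftsBy-∏ (1≤g ∘ Fin.suc) (s ∘ Fin.suc))

  shiftsBy-2 : ShiftsBy 2 1
  shiftsBy-2 {u = zero} _ _ Λ-2 = Λ-2^ 1
  shiftsBy-2 {y} {suc u} 1≤y 2∣y l =
    let (1≤fy , 2∣fy , l′) = even-orbit 1≤y 2∣y l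
    in Λ-f (subst (λ n → Λ n (u + 1)) (sym (f-*-∣ prime[2] 1≤y 2∣y)) (shiftsBy-2 1≤fy 2∣fy l′))

  shiftsBy-oddPrime : ∀ {q z w} → Prime q → q ≢ 2 → q + 1 ≡ z * 2 → ShiftsBy z w →
    ShiftsBy q (suc w)
  shiftsBy-oddPrime {q} {z} {w} pq q≢2 q+1≡2z sz = go
    where
    f-q* : ∀ {y} → ¬ q ∣ y → f (q * y) ≡ z * (2 * f y)
    f-q* {y} q∤y = begin
      f (q * y)      ≡⟨ f-*-coprime pq q∤y ⟩
      f q * f y      ≡⟨ cong (_* f y) (trans (f-oddPrime pq q≢2) q+1≡2z) ⟩
      z * 2 * f y    ≡⟨ *-assoc z 2 (f y) ⟩
      z * (2 * f y)  ∎
      where open ≡-Reasoning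
    q∤2 : ¬ q ∣ 2
    q∤2 q∣2 = q≢2 (≤-antisym (∣⇒≤ q∣2) (prime⇒1< pq))
    go : ShiftsBy q (suc w)
    go {u = zero} _ _ Λ-2 =
      Λ-f (subst (λ n → Λ n w) (sym (trans (f-q* q∤2) (cong (λ x → z * (2 * x)) f-2))) (shiftsBy⇒Λ {z} sz))
    go {y} {suc u} 1≤y 2∣y l with even-orbit 1≤y 2∣y l | q ∣? y
    ... | 1≤fy , 2∣fy , l′ | yes q∣y =
      Λ-f (subst (λ n → Λ n (u + suc w)) (sym (f-*-∣ pq 1≤y q∣y)) (go 1≤fy 2∣fy l′))
    ... | 1≤fy , 2∣fy , l′ | no q∤y =
      Λ-f (subst₂ Λ (sym (f-q* q∤y)) (+-assoc u 1 w)
        (sz (*-mono-≤ {1} {2} (s≤s z≤n) 1≤fy) (m∣m*n (f y)) (shiftsBy-2 1≤fy 2∣fy l′)))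

  shiftsBy-prime : ∀ {q} → Prime q → (∀ {m} → 1 ≤ m → m < q → ∃ (ShiftsBy m)) → ∃ (ShiftsBy q)
  shiftsBy-prime {q} pq ih with q ≟ 2
  ... | yes refl = 1 , shiftsBy-2
  ... | no q≢2 = let (w , sz) = ih 1≤z z<q in suc w , shiftsBy-oddPrime {z = z} pq q≢2 q+1≡2z sz
    where
    2∣q+1 = odd⇒2∣+1 (prime≢2⇒odd pq q≢2)
    z = quotient 2∣q+1
    q+1≡2z : q + 1 ≡ z * 2
    q+1≡2z = _∣_.equality 2∣q+1
    1≤z : 1 ≤ z
    1≤z = 1≤*⇒1≤ʳ 2 (subst (1 ≤_) (trans q+1≡2z (*-comm z 2)) (m≤n+m 1 q))
    z<q : z < q
    z<q = *-cancelʳ-< 2 z q (begin-strict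
      z * 2    ≡⟨ q+1≡2z ⟨
      q + 1    <⟨ +-monoʳ-< q (prime⇒1< pq) ⟩
      q + q    ≡⟨ cong (λ x → q + x) (+-identityʳ q) ⟨
      2 * q    ≡⟨ *-comm 2 q ⟩
      q * 2    ∎)
      where open ≤-Reasoning

  shiftsBy-exists : ∀ n → 1 ≤ n → ∃ (ShiftsBy n)
  shiftsBy-exists = prime-*-induction (∃ ∘ ShiftsBy) (0 , shiftsBy-1) step
    where
    step : ∀ {q n} → Prime q → 1 ≤ n → (∀ {m} → 1 ≤ m → m < q * n → ∃ (ShiftsBy m)) →
      ∃ (ShiftsBy (q * n))
    step {q} {n} pq 1≤n ih =
      let (v , sq) = shiftsBy-prime pq (λ 1≤m m<q → ih 1≤m (<-≤-trans m<q (m≤m*n q n {{>-nonZero 1≤n}})))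
          (w , sn) = ih 1≤n (m<n*m 1≤n (prime⇒1< pq))
      in v + w , shiftsBy-* (<⇒≤ (prime⇒1< pq)) sq sn

  shiftsBy-odd : ∀ {n k} → ¬ 2 ∣ n → Λ n k → ShiftsBy n k
  shiftsBy-odd {n} {k} 2∤n l with shiftsBy-exists n (odd⇒1≤ 2∤n)
  ... | w , sn
    with Λ-unique (subst (λ m → Λ m k) (*-comm 2 n) (Λ-2*-odd 2∤n l)) (shiftsBy⇒Λ {n} sn)
  ... | refl = sn

  Λ-2^*∏ : ∀ {r} (p a lam : Fin r → ℕ) → (∀ i → ¬ 2 ∣ p i) → (∀ i → Λ (p i) (lam i)) →
    ∀ b → Λ (2 ^ suc b * ∏ (λ i → p i ^ a i)) (b + ∑ (λ i → a i * lam i))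
  Λ-2^*∏ p a lam p-odd l b =
    subst (λ n → Λ n (b + ∑ λ i → a i * lam i)) (*-comm t (2 ^ suc b))
      (t-shifts (m^n>0 2 (suc b)) (m∣m*n (2 ^ b)) (Λ-2^ b))
    where
    t = ∏ (λ i → p i ^ a i)
    1≤pᵃ : ∀ i → 1 ≤ p i ^ a i
    1≤pᵃ i = m^n>0 (p i) {{>-nonZero (odd⇒1≤ (p-odd i))}} (a i)
    pᵃ-shifts : ∀ i → ShiftsBy (p i ^ a i) (a i * lam i)
    pᵃ-shifts i = shiftsBy-^ (odd⇒1≤ (p-odd i)) (shiftsBy-odd (p-odd i) (l i)) (a i)
    t-shifts : ShiftsBy t (∑ λ i → a i * lam i)
    t-shifts = shiftsBy-∏ 1≤pᵃ pᵃ-shifts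

lemma2p5 : (f : ℕ → ℕ) → IsPsiBar f →
    (r : ℕ) → 1 ≤ r → (α : ℕ) → 1 ≤ α → (c : ℝ) →
    (p : Fin r → ℕ) → (∀ i → Prime (p i)) → (∀ i → ¬ (2 ∣ p i)) → Injective _≡_ _≡_ p →
    (a : Fin r → ℕ) → (∀ i → 1 ≤ a i) →
    (lam : Fin r → ℕ) → (∀ i → IsLambda f (p i) (lam i)) →
    (k : ℕ) → IsLambda f (2 ^ α * ∏ (λ i → p i ^ a i)) k →
    (c >[ + k ]-log₂ (2 ^ α * ∏ (λ i → p i ^ a i)))
      ⇔ (c >[ (+ ∑ (λ i → a i * lam i)) ℤ.- (+ 1) ]-log₂ (∏ (λ i → p i ^ a i)))
lemma2p5 f ψ r _ (suc α) _ c p _ p-odd _ a _ lam λp k λk =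
  subst (λ K → (c >[ K ]-log₂ (2 ^ suc α * t)) ⇔ (c >[ + S ℤ.- + 1 ]-log₂ t)) (sym +k≡)
    (>-log₂-shift c (+ S ℤ.- + 1) (suc α) t)
  where
  open PsiBar ψ
  t = ∏ (λ i → p i ^ a i)
  S = ∑ (λ i → a i * lam i)
  k≡α+S : k ≡ α + S
  k≡α+S = Λ-unique (isLambda⇒Λ k λk) (Λ-2^*∏ p a lam p-odd (λ i → isLambda⇒Λ (lam i) (λp i)) α)
  regroup : ∀ a s → a ℤ.+ s ≡ (s ℤ.- + 1) ℤ.+ (+ 1 ℤ.+ a)
  regroup = solve-∀
  +k≡ : + k ≡ (+ S ℤ.- + 1) ℤ.+ + suc α
  +k≡ = trans (cong +_ k≡α+S) (trans (ℤ.pos-+ α S) (regroup (+ α) (+ S)))
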